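{- Let $\mathcal{R}_{\mathrm{grid}}$ be the rule set over $\{H,V\}$ ($H,V$ binary) consisting of (loop) $\top\to\exists x\,(H(x,x)\wedge V(x,x))$, (grow) $\top(x)\to\exists y\,\exists y'\,(H(x,y)\wedge V(x,y'))$, (grid) $H(x,y)\wedge V(x,x')\to\exists y'\,(H(x',y')\wedge V(y,y'))$, let $\mathcal{D}_{\mathrm{grid}}=\{\top(a)\}$ for a constant $a$, and let $\mathcal{G}_\infty=\{H(a,x_{1,0}),V(a,x_{0,1}),H(y,y),V(y,y)\}\cup\{H(x_{i,j},x_{i+1,j}),V(x_{i,j},x_{i,j+1})\mid (i,j)\in(\mathbb{N}\times\mathbb{N})\setminus\{(0,0)\}\}$, where $y$ and the $x_{i,j}$ are pairwise distinct nulls. Then: (1) $\mathcal{G}_\infty$ has infinite cliquewidth; (2) $\mathcal{G}_\infty$ is a universal model of $(\mathcal{D}_{\mathrm{grid}},\mathcal{R}_{\mathrm{grid}})$; (3) the only homomorphism $h:\mathcal{G}_\infty\to\mathcal{G}_\infty$ is the identity; (4) every universal model of $(\mathcal{D}_{\mathrm{grid}},\mathcal{R}_{\mathrm{grid}})$ contains an induced sub-instance isomorphic to $\mathcal{G}_\infty$; (5) $(\mathcal{D}_{\mathrm{grid}},\mathcal{R}_{\mathrm{grid}})$ has no universal model of finite cliquewidth.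
   Context: $\top$ is a unary predicate holding of every term. Instances: countable sets of atoms with constants or nulls as terms; homomorphisms are identity on constants and preserve atoms. A model of $(\mathcal{D},\mathcal{R})$ is an instance containing $\mathcal{D}$ satisfying every rule; a universal model is a model with a homomorphism into every model. Cliquewidth: for a finite color set $\mathbb{L}$ and finite constant set $\mathrm{Cnst}$, a well-decorated tree labels each node of the infinite binary tree $\{0,1\}^*$ by exactly one of $c_k$ ($c\in\mathrm{Cnst}\cup\{*\}$), $\mathrm{Add}_{R,\vec k}$, $\mathrm{Recolor}_{k\to k'}$, $\oplus$, $\mathrm{Void}$, with: each constant decorated at most once; $\mathrm{Add}$/$\mathrm{Recolor}$ nodes have non-$\mathrm{Void}$ left and $\mathrm{Void}$ right child; $\oplus$ nodes have two non-$\mathrm{Void}$ children; $\mathrm{Void}$ and $c_k$ nodes have $\mathrm{Void}$ children. Node $s$ represents the elements introduced in its subtree ($*_k$ introduces the node itself as a null, $c_k$ the constant $c$), colored by introduction color as modified by $\mathrm{Recolor}_{k\to k'}$ nodes on the path up to $s$; $\oplus$ is disjoint union; $\mathrm{Add}_{R,\vec k}$ adds $R(\vec e)$ for all tuples $\vec e$ of its elements colored $\vec k$. $\mathrm{cw}(I)$ is the least $|\mathbb{L}|$ such that some coloring of $I$ is isomorphic to the colored instance represented by a well-decorated tree ($\infty$ if none). -}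

module Defs where

open import Data.Nat using (ℕ; zero; suc; _+_; _*_; _^_)
open import Data.Fin using (Fin; _≟_)
open import Data.Bool using (Bool; true; false)
open import Data.List using (List; []; _∷_; _++_)
open import Data.List.Membership.Propositional using (_∈_)
open import Data.Product using (Σ; _×_; _,_; ∃)
open import Data.Sum using (_⊎_; inj₁; inj₂)
open import Data.Empty using (⊥)
open import Data.Unit using (⊤; tt)
open import Relation.Nullary using (¬_; yes; no)
open import Relation.Binary.PropositionalEquality using (_≡_)

data Term : Set where
  const : ℕ → Term
  null  : ℕ → Term

-- Instances over the signature {⊤, H, V}.  ⊤ holds of exactly the terms
-- of the instance (Dom); H and V are binary.  Countability is automatic
-- since Term is countable.

record Instance : Set₁ where
  field
    Dom : Term → Set
    H   : Term → Term → Set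
    V   : Term → Term → Set
    H-dom : ∀ {s t} → H s t → Dom s × Dom t
    V-dom : ∀ {s t} → V s t → Dom s × Dom t
open Instance public

record Hom (I J : Instance) : Set where
  field
    map      : Term → Term
    const-id : ∀ c → map (const c) ≡ const c
    pres-Dom : ∀ {t} → Dom I t → Dom J (map t)
    pres-H   : ∀ {s t} → H I s t → H J (map s) (map t)
    pres-V   : ∀ {s t} → V I s t → V J (map s) (map t)
open Hom public

record Iso (I J : Instance) : Set where
  field
    to   : Hom I J
    from : Hom J I
    from-to : ∀ t → Dom I t → map from (map to t) ≡ t
    to-from : ∀ t → Dom J t → map to (map from t) ≡ t
open Iso public

Induced : Instance → (Term → Set) → Instance
Induced I S = record
  { Dom = λ t → Dom I t × S t
  ; H = λ s t → H I s t × S s × S t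
  ; V = λ s t → V I s t × S s × S t
  ; H-dom = λ { (h , ss , st) → (proj₁ (H-dom I h) , ss) , (proj₂ (H-dom I h) , st) }
  ; V-dom = λ { (v , ss , st) → (proj₁ (V-dom I v) , ss) , (proj₂ (V-dom I v) , st) }
  }
  where open Data.Product using (proj₁; proj₂)

a : Term
a = const 0

ContainsDgrid : Instance → Set
ContainsDgrid I = Dom I a

SatLoop : Instance → Set
SatLoop I = Σ Term λ x → H I x x × V I x x

SatGrow : Instance → Set
SatGrow I = ∀ x → Dom I x → Σ Term λ y → Σ Term λ y' → H I x y × V I x y'

SatGrid : Instance → Set
SatGrid I = ∀ x y x' → H I x y → V I x x' → Σ Term λ y' → H I x' y' × V I y y'

Model : Instance → Set
Model I = ContainsDgrid I × SatLoop I × SatGrow I × SatGrid I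

Universal : Instance → Set₁
Universal I = Model I × (∀ J → Model J → Hom I J)

y : Term
y = null 0

x : ℕ → ℕ → Term
x i j = null (2 ^ i * suc (2 * j))

NonOrigin : ℕ → ℕ → Set
NonOrigin i j = ¬ (i ≡ 0 × j ≡ 0)

G∞-H : Term → Term → Set
G∞-H s t = (s ≡ a × t ≡ x 1 0)
         ⊎ (s ≡ y × t ≡ y)
         ⊎ Σ ℕ λ i → Σ ℕ λ j → NonOrigin i j × s ≡ x i j × t ≡ x (suc i) j

G∞-V : Term → Term → Set
G∞-V s t = (s ≡ a × t ≡ x 0 1)
         ⊎ (s ≡ y × t ≡ y)
         ⊎ Σ ℕ λ i → Σ ℕ λ j → NonOrigin i j × s ≡ x i j × t ≡ x i (suc j)

G∞-Dom : Term → Set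
G∞-Dom t = Σ Term λ s → G∞-H t s ⊎ G∞-H s t ⊎ G∞-V t s ⊎ G∞-V s t

G∞ : Instance
G∞ = record
  { Dom = G∞-Dom
  ; H = G∞-H
  ; V = G∞-V
  ; H-dom = λ {s} {t} h → (t , inj₁ h) , (s , inj₂ (inj₁ h))
  ; V-dom = λ {s} {t} v → (t , inj₂ (inj₂ (inj₁ v))) , (s , inj₂ (inj₂ (inj₂ v)))
  }

-- Nodes of {0,1}* are List Bool, where the
-- children of node s are (false ∷ s) (left, "s0") and (true ∷ s)
-- (right, "s1"); the root is [].  (This is just a bijective encoding of
-- {0,1}*: words are stored last-letter-first.)

data Label (n : ℕ) : Set where
  cnst    : ℕ → Fin n → Label n
  star    : Fin n → Label n
  addH    : Fin n → Fin n → Label n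
  addV    : Fin n → Fin n → Label n
  recolor : Fin n → Fin n → Label n
  oplus   : Label n
  void    : Label n

IsVoid : ∀ {n} → Label n → Set
IsVoid void = ⊤
IsVoid _    = ⊥

ChildCond : ∀ {n} → Label n → Label n → Label n → Set
ChildCond (cnst _ _)    l r = IsVoid l × IsVoid r
ChildCond (star _)      l r = IsVoid l × IsVoid r
ChildCond (addH _ _)    l r = ¬ IsVoid l × IsVoid r
ChildCond (addV _ _)    l r = ¬ IsVoid l × IsVoid r
ChildCond (recolor _ _) l r = ¬ IsVoid l × IsVoid r
ChildCond oplus         l r = ¬ IsVoid l × ¬ IsVoid r
ChildCond void          l r = IsVoid l × IsVoid r

Node : Set
Node = List Bool

record WellDecorated (n : ℕ) (Cnst : List ℕ) (d : Node → Label n) : Set where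
  field
    cnst-in   : ∀ s c k → d s ≡ cnst c k → c ∈ Cnst
    cnst-once : ∀ s s' c k k' → d s ≡ cnst c k → d s' ≡ cnst c k' → s ≡ s'
    children  : ∀ s → ChildCond (d s) (d (false ∷ s)) (d (true ∷ s))

-- injective (indeed bijective) naming of tree nodes as nulls
encNode : Node → ℕ
encNode []          = 0
encNode (false ∷ w) = suc (2 * encNode w)
encNode (true ∷ w)  = suc (suc (2 * encNode w))

data Intro {n : ℕ} (t : Node) : Label n → Term → Fin n → Set where
  intro-cnst : ∀ c k → Intro t (cnst c k) (const c) k
  intro-star : ∀ k → Intro t (star k) (null (encNode t)) k

recol : ∀ {n} → Label n → Fin n → Fin n
recol (recolor k k') m with m ≟ k
... | yes _ = k'
... | no  _ = m
recol _ m = m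

-- colour, as seen at node s, of an element introduced at node u ++ s
-- with introduction colour k: apply the Recolor nodes on the path from
-- u ++ s up to and including s.
colour : ∀ {n} → (Node → Label n) → (u s : Node) → Fin n → Fin n
colour d []      s k = recol (d s) k
colour d (b ∷ u) s k = colour d u s (recol (d (b ∷ u ++ s)) k)

Elem : ∀ {n} → (Node → Label n) → Node → Term → Fin n → Set
Elem d s e k = Σ Node λ u → Σ _ λ k₀ → Intro (u ++ s) (d (u ++ s)) e k₀ × colour d u s k₀ ≡ k

RepH : ∀ {n} → (Node → Label n) → Term → Term → Set
RepH d e e' = Σ Node λ s → Σ _ λ k → Σ _ λ k' → d s ≡ addH k k' × Elem d s e k × Elem d s e' k'

RepV : ∀ {n} → (Node → Label n) → Term → Term → Set
RepV d e e' = Σ Node λ s → Σ _ λ k → Σ _ λ k' → d s ≡ addV k k' × Elem d s e k × Elem d s e' k'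

elem-root : ∀ {n} (d : Node → Label n) s e k → Elem d s e k → Σ Node λ t → Σ _ λ k₀ → Intro t (d t) e k₀
elem-root d s e k (u , k₀ , i , _) = u ++ s , k₀ , i

Rep : ∀ {n} → (Node → Label n) → Instance
Rep d = record
  { Dom = λ e → Σ Node λ t → Σ _ λ k → Intro t (d t) e k
  ; H = RepH d
  ; V = RepV d
  ; H-dom = λ { (s , k , k' , _ , el , el') → elem-root d s _ k el , elem-root d s _ k' el' }
  ; V-dom = λ { (s , k , k' , _ , el , el') → elem-root d s _ k el , elem-root d s _ k' el' }
  }

RootColour : ∀ {n} → (Node → Label n) → Term → Fin n → Set
RootColour d e k = Elem d [] e k

CWAtMost : ℕ → Instance → Set
CWAtMost n I =
  Σ (List ℕ) λ Cnst → Σ (Node → Label n) λ d → WellDecorated n Cnst d ×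
  Σ (Term → Fin n) λ κ → Σ (Iso I (Rep d)) λ φ →
    ∀ t → Dom I t → RootColour d (map (to φ) t) (κ t)

FiniteCW : Instance → Set
FiniteCW I = Σ ℕ λ n → CWAtMost n I

{-# OPTIONS --safe #-}
-- In G∞ the constant a and the nulls x i j, (i , j) ≠ (0 , 0), form the quadrant grid ℕ × ℕ,
-- and y is a separate loop. Grow and grid rebuild this quadrant row by row inside any model, so
-- G∞ is universal; an endomorphism fixes a and then, following the unique H- and V-successors,
-- every grid point, so G∞ is rigid. Consequently G∞ is a retract G∞ → U → G∞ of every universal
-- model U, which yields the induced copy, and (1) and (5) both reduce to: G∞ is not a retract of
-- an instance represented by a well-decorated tree with n colours. For this take m > 4n and the
-- m × m subgrid. An Add node above a node s sees the elements introduced below s only through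
-- their colours at s, and the retraction to G∞ forbids spurious edges; so at most 2n rows (and
-- 2n columns) cross the boundary of the subtree at s. Hence, if the subtree at s contains a whole
-- row, so does the subtree at one of its children, and this descent cannot go on forever,
-- because the grid elements are introduced at finitely many nodes.
module Submission where

open import Defs
open import Data.Bool using (Bool; true; false)
open import Data.Empty using (⊥; ⊥-elim)
open import Data.Fin using (Fin; toℕ; join; splitAt)
open import Data.Fin.Properties using (toℕ<n; toℕ-injective; injective⇒≤; splitAt-join)
open import Data.List using ([]; _∷_; _++_; length; initLast; _∷ʳ′_)
open import Data.List.Properties using (++-assoc; ++-cancelʳ; ∷-injective; ∷ʳ-++; ++-identityʳ; length-++; ≡-dec)
open import Data.Bool.Properties using () renaming (_≟_ to _≟ᵇ_)
open import Data.Nat using (ℕ; zero; suc; _+_; _*_; _^_; _≤_; _<_; _⊔_; s≤s; z<s)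
open import Data.Nat.Properties
open import Data.Product using (Σ; ∃; ∃₂; _×_; _,_; proj₁; proj₂; map₁; map₂; uncurry′)
open import Data.Sum using (_⊎_; inj₁; inj₂)
import Data.Sum as Sum
open import Data.Sum.Properties using (inj₁-injective; inj₂-injective)
open import Function using (_∘_; id)
open import Function.Definitions using (Injective)
open import Relation.Nullary using (¬_; Dec; yes; no)
open import Relation.Nullary.Decidable using (decidable-stable; ¬?; _×-dec_; _⊎-dec_)
open import Relation.Unary using (Decidable)
open import Relation.Binary.PropositionalEquality

-- Counting

join-injective : ∀ {m n} {i j : Fin m ⊎ Fin n} → join m n i ≡ join m n j → i ≡ j
join-injective {m} {n} {i} {j} eq =
  trans (sym (splitAt-join m n i)) (trans (cong (splitAt m) eq) (splitAt-join m n j))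

record Signed (P : ℕ → Set) (N : ℕ) : Set where
  field
    signature           : ∀ {r} → P r → Fin N
    signature-injective : ∀ {r r′} (p : P r) (p′ : P r′) → signature p ≡ signature p′ → r ≡ r′
open Signed

_⊎-signed_ : ∀ {P Q : ℕ → Set} {N N′} → Signed P N → Signed Q N′ → Signed (λ r → P r ⊎ Q r) (N + N′)
_⊎-signed_ {P} {Q} {N} {N′} σ τ = record
  { signature           = join N N′ ∘ tag
  ; signature-injective = λ p p′ eq → tag-injective p p′ (join-injective {i = tag p} {tag p′} eq)
  }
  where
  tag : ∀ {r} → P r ⊎ Q r → Fin N ⊎ Fin N′
  tag = Sum.map (signature σ) (signature τ)
  tag-injective : ∀ {r r′} (p : P r ⊎ Q r) (p′ : P r′ ⊎ Q r′) → tag p ≡ tag p′ → r ≡ r′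
  tag-injective (inj₁ p) (inj₁ p′) eq = signature-injective σ p p′ (inj₁-injective eq)
  tag-injective (inj₂ q) (inj₂ q′) eq = signature-injective τ q q′ (inj₂-injective eq)
  tag-injective (inj₁ _) (inj₂ _)  ()
  tag-injective (inj₂ _) (inj₁ _)  ()

∃¬-signed : ∀ {P : ℕ → Set} {N m} → Decidable P → Signed P N → N < m → ∃ λ r → r < m × ¬ P r
∃¬-signed {P} {N} {m} P? σ N<m with anyUpTo? (¬? ∘ P?) m
... | yes found = found
... | no none   = ⊥-elim (<⇒≱ N<m (injective⇒≤ injective))
  where
  everywhere : (i : Fin m) → P (toℕ i)
  everywhere i = decidable-stable (P? (toℕ i)) (λ ¬p → none (toℕ i , toℕ<n i , ¬p))
  injective : Injective _≡_ _≡_ (λ i → signature σ (everywhere i))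
  injective eq = toℕ-injective (signature-injective σ (everywhere _) (everywhere _) eq)

step-invariant⇒constant : ∀ {P : ℕ → Set} {M} → (∀ k → k < M → (P k → P (suc k)) × (P (suc k) → P k)) →
                          ∀ {k k′} → k ≤ M → k′ ≤ M → P k → P k′
step-invariant⇒constant {P} {M} step k≤M k′≤M = up k′≤M ∘ down k≤M
  where
  down : ∀ {k} → k ≤ M → P k → P 0
  down {zero}  _   p = p
  down {suc k} k<M p = down (<⇒≤ k<M) (proj₂ (step k k<M) p)
  up : ∀ {k} → k ≤ M → P 0 → P k
  up {zero}  _   p = p
  up {suc k} k<M p = proj₁ (step k k<M) (up (<⇒≤ k<M) p)

maxUpTo : ℕ → (ℕ → ℕ) → ℕ
maxUpTo zero    h = 0
maxUpTo (suc m) h = h m ⊔ maxUpTo m h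

≤-maxUpTo : ∀ {m} h {i} → i < m → h i ≤ maxUpTo m h
≤-maxUpTo {suc m} h {i} i<1+m with m≤n⇒m<n∨m≡n (≤-pred i<1+m)
... | inj₁ i<m  = ≤-trans (≤-maxUpTo h i<m) (m≤n⊔m (h m) (maxUpTo m h))
... | inj₂ refl = m≤m⊔n (h i) (maxUpTo m h)

-- Decoding the nulls x i j

x-index≢0 : ∀ i j → 2 ^ i * suc (2 * j) ≢ 0
x-index≢0 i j eq with m^n≡0⇒m≡0 2 i (m*n≡0⇒m≡0 (2 ^ i) (suc (2 * j)) eq)
... | ()

halve : ℕ → Bool × ℕ
halve zero          = false , 0
halve (suc zero)    = true , 0
halve (suc (suc n)) = map₂ suc (halve n)

halve-even : ∀ k → halve (2 * k) ≡ (false , k)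
halve-even zero    = refl
halve-even (suc k) rewrite +-suc k (k + 0) = cong (map₂ suc) (halve-even k)

halve-odd : ∀ k → halve (suc (2 * k)) ≡ (true , k)
halve-odd zero    = refl
halve-odd (suc k) rewrite +-suc k (k + 0) = cong (map₂ suc) (halve-odd k)

-- Removes up to fuel factors 2; the fuel n used by decode n suffices since i < 2 ^ i.
strip : (fuel : ℕ) → ℕ → ℕ × ℕ
strip zero       _ = 0 , 0
strip (suc fuel) n with halve n
... | false , h = map₁ suc (strip fuel h)
... | true  , h = 0 , h

strip-x : ∀ {fuel} i j → i < fuel → strip fuel (2 ^ i * suc (2 * j)) ≡ (i , j)
strip-x {suc _} zero j _ rewrite +-identityʳ (suc (2 * j)) | halve-odd j = refl
strip-x {suc _} (suc i) j (s≤s i<fuel)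
  rewrite *-assoc 2 (2 ^ i) (suc (2 * j)) | halve-even (2 ^ i * suc (2 * j)) =
  cong (map₁ suc) (strip-x i j i<fuel)

n<2^n : ∀ n → n < 2 ^ n
n<2^n zero    = z<s
n<2^n (suc n) = +-mono-≤-< (m^n>0 2 n) (subst (n <_) (sym (+-identityʳ (2 ^ n))) (n<2^n n))

decode : ℕ → ℕ × ℕ
decode n = strip n n

decode-x : ∀ i j → decode (2 ^ i * suc (2 * j)) ≡ (i , j)
decode-x i j = strip-x i j (<-≤-trans (n<2^n i) (m≤m*n (2 ^ i) (suc (2 * j))))

null-injective : ∀ {m n} → null m ≡ null n → m ≡ n
null-injective refl = refl

x≢y : ∀ i j → x i j ≢ y
x≢y i j = x-index≢0 i j ∘ null-injective

-- The grid G∞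

-- The constant a plays the role of the missing null x 0 0.
pt : ℕ → ℕ → Term
pt zero    zero    = a
pt zero    (suc j) = x 0 (suc j)
pt (suc i) j       = x (suc i) j

pt-nonOrigin : ∀ {i j} → NonOrigin i j → pt i j ≡ x i j
pt-nonOrigin {zero}  {zero}  o = ⊥-elim (o (refl , refl))
pt-nonOrigin {zero}  {suc j} o = refl
pt-nonOrigin {suc i} {j}     o = refl

coordinates : Term → ℕ × ℕ
coordinates (const _) = 0 , 0
coordinates (null k)  = decode k

coordinates-pt : ∀ i j → coordinates (pt i j) ≡ (i , j)
coordinates-pt zero    zero    = refl
coordinates-pt zero    (suc j) = decode-x 0 (suc j)
coordinates-pt (suc i) j       = decode-x (suc i) j

pt-injective : ∀ {i j i′ j′} → pt i j ≡ pt i′ j′ → (i , j) ≡ (i′ , j′)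
pt-injective {i} {j} {i′} {j′} eq = begin
  (i , j)              ≡⟨ sym (coordinates-pt i j) ⟩
  coordinates (pt i j)   ≡⟨ cong coordinates eq ⟩
  coordinates (pt i′ j′) ≡⟨ coordinates-pt i′ j′ ⟩
  (i′ , j′)            ∎
  where open ≡-Reasoning

pt≢y : ∀ i j → pt i j ≢ y
pt≢y zero    zero    ()
pt≢y zero    (suc j) = x≢y 0 (suc j)
pt≢y (suc i) j       = x≢y (suc i) j

G∞-H-pt : ∀ i j → G∞-H (pt i j) (pt (suc i) j)
G∞-H-pt zero    zero    = inj₁ (refl , refl)
G∞-H-pt zero    (suc j) = inj₂ (inj₂ (0 , suc j , (λ { (_ , ()) }) , refl , refl))
G∞-H-pt (suc i) j       = inj₂ (inj₂ (suc i , j , (λ { (() , _) }) , refl , refl))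

G∞-V-pt : ∀ i j → G∞-V (pt i j) (pt i (suc j))
G∞-V-pt zero    zero    = inj₁ (refl , refl)
G∞-V-pt zero    (suc j) = inj₂ (inj₂ (0 , suc j , (λ { (_ , ()) }) , refl , refl))
G∞-V-pt (suc i) j       = inj₂ (inj₂ (suc i , j , (λ { (() , _) }) , refl , refl))

G∞-loop : G∞-H y y × G∞-V y y
G∞-loop = inj₂ (inj₁ (refl , refl)) , inj₂ (inj₁ (refl , refl))

H-view : ∀ {s t} → G∞-H s t →
         (s ≡ y × t ≡ y) ⊎ ∃₂ λ i j → s ≡ pt i j × t ≡ pt (suc i) j
H-view (inj₁ (refl , refl))                  = inj₂ (0 , 0 , refl , refl)
H-view (inj₂ (inj₁ loop))                    = inj₁ loop
H-view (inj₂ (inj₂ (i , j , o , refl , refl))) = inj₂ (i , j , sym (pt-nonOrigin o) , refl)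

V-view : ∀ {s t} → G∞-V s t →
         (s ≡ y × t ≡ y) ⊎ ∃₂ λ i j → s ≡ pt i j × t ≡ pt i (suc j)
V-view (inj₁ (refl , refl))                  = inj₂ (0 , 0 , refl , refl)
V-view (inj₂ (inj₁ loop))                    = inj₁ loop
V-view (inj₂ (inj₂ (i , j , o , refl , refl))) =
  inj₂ (i , j , sym (pt-nonOrigin o) , sym (pt-nonOrigin λ { (_ , ()) }))

H-succ : ∀ {i j t} → G∞-H (pt i j) t → t ≡ pt (suc i) j
H-succ e with H-view e
... | inj₁ (p≡y , _) = ⊥-elim (pt≢y _ _ p≡y)
... | inj₂ (_ , _ , eq , refl) with pt-injective eq
... | refl = refl

V-succ : ∀ {i j t} → G∞-V (pt i j) t → t ≡ pt i (suc j)
V-succ e with V-view e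
... | inj₁ (p≡y , _) = ⊥-elim (pt≢y _ _ p≡y)
... | inj₂ (_ , _ , eq , refl) with pt-injective eq
... | refl = refl

H-pred : ∀ {i j s} → G∞-H s (pt (suc i) j) → s ≡ pt i j
H-pred {i} {j} e with H-view e
... | inj₁ (_ , p≡y) = ⊥-elim (pt≢y (suc i) j p≡y)
H-pred {i} {j} e | inj₂ (i′ , j′ , refl , eq) with pt-injective {suc i} {j} {suc i′} {j′} eq
... | refl = refl

V-pred : ∀ {i j s} → G∞-V s (pt i (suc j)) → s ≡ pt i j
V-pred {i} {j} e with V-view e
... | inj₁ (_ , p≡y) = ⊥-elim (pt≢y i (suc j) p≡y)
V-pred {i} {j} e | inj₂ (i′ , j′ , refl , eq) with pt-injective {i} {suc j} {i′} {suc j′} eq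
... | refl = refl

H-loop : ∀ {t} → G∞-H t t → t ≡ y
H-loop e with H-view e
... | inj₁ (t≡y , _) = t≡y
... | inj₂ (i , j , eq , eq′) with pt-injective {i} {j} {suc i} {j} (trans (sym eq) eq′)
... | ()

Vertex : Term → Set
Vertex t = t ≡ y ⊎ ∃₂ λ i j → t ≡ pt i j

H-endpoints : ∀ {s t} → G∞-H s t → Vertex s × Vertex t
H-endpoints e with H-view e
... | inj₁ (s≡y , t≡y)           = inj₁ s≡y , inj₁ t≡y
... | inj₂ (i , j , s≡p , t≡p) = inj₂ (i , j , s≡p) , inj₂ (suc i , j , t≡p)

V-endpoints : ∀ {s t} → G∞-V s t → Vertex s × Vertex t
V-endpoints e with V-view e
... | inj₁ (s≡y , t≡y)           = inj₁ s≡y , inj₁ t≡y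
... | inj₂ (i , j , s≡p , t≡p) = inj₂ (i , j , s≡p) , inj₂ (i , suc j , t≡p)

G∞-Dom⇒Vertex : ∀ {t} → G∞-Dom t → Vertex t
G∞-Dom⇒Vertex (_ , inj₁ e)                = proj₁ (H-endpoints e)
G∞-Dom⇒Vertex (_ , inj₂ (inj₁ e))         = proj₂ (H-endpoints e)
G∞-Dom⇒Vertex (_ , inj₂ (inj₂ (inj₁ e)))  = proj₁ (V-endpoints e)
G∞-Dom⇒Vertex (_ , inj₂ (inj₂ (inj₂ e)))  = proj₂ (V-endpoints e)

pt∈G∞ : ∀ i j → G∞-Dom (pt i j)
pt∈G∞ i j = pt (suc i) j , inj₁ (G∞-H-pt i j)

G∞-rigid : (h : Hom G∞ G∞) → ∀ t → Dom G∞ t → map h t ≡ t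
G∞-rigid h t t∈G∞ with G∞-Dom⇒Vertex t∈G∞
... | inj₁ refl               = H-loop (pres-H h (proj₁ G∞-loop))
... | inj₂ (i , j , refl) = fixes i j
  where
  fixes : ∀ i j → map h (pt i j) ≡ pt i j
  fixes zero    zero    = const-id h 0
  fixes (suc i) j       = H-succ {i} {j} (subst (λ s → G∞-H s (map h (pt (suc i) j))) (fixes i j) (pres-H h (G∞-H-pt i j)))
  fixes zero    (suc j) = V-succ {0} {j} (subst (λ s → G∞-V s (map h (pt 0 (suc j)))) (fixes 0 j) (pres-V h (G∞-V-pt 0 j)))

G∞-model : Model G∞
G∞-model = pt∈G∞ 0 0 , (y , G∞-loop) , grow , grid
  where
  grow : SatGrow G∞
  grow t t∈G∞ with G∞-Dom⇒Vertex t∈G∞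
  ... | inj₁ refl           = y , y , G∞-loop
  ... | inj₂ (i , j , refl) = pt (suc i) j , pt i (suc j) , G∞-H-pt i j , G∞-V-pt i j
  grid : SatGrid G∞
  grid s t s′ h v with H-view h | V-view v
  ... | inj₁ (refl , refl) | inj₁ (_ , refl) = y , G∞-loop
  ... | inj₁ (refl , _) | inj₂ (i , j , y≡p , _) = ⊥-elim (pt≢y i j (sym y≡p))
  ... | inj₂ (i , j , refl , _) | inj₁ (p≡y , _) = ⊥-elim (pt≢y i j p≡y)
  ... | inj₂ (i , j , refl , refl) | inj₂ (_ , _ , eq , refl) with pt-injective eq
  ... | refl = pt (suc i) (suc j) , G∞-H-pt i (suc j) , G∞-V-pt (suc i) j

-- Homomorphisms

idᴴ : ∀ {I} → Hom I I
idᴴ = record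
  { map = id ; const-id = λ _ → refl ; pres-Dom = id ; pres-H = id ; pres-V = id }

_∘ᴴ_ : ∀ {I J K} → Hom J K → Hom I J → Hom I K
g ∘ᴴ f = record
  { map      = map g ∘ map f
  ; const-id = λ c → trans (cong (map g) (const-id f c)) (const-id g c)
  ; pres-Dom = pres-Dom g ∘ pres-Dom f
  ; pres-H   = pres-H g ∘ pres-H f
  ; pres-V   = pres-V g ∘ pres-V f
  }

universal-hom : ∀ {I J} → Universal I → Model J → Hom I J
universal-hom uI mJ = proj₂ uI _ mJ

Image : ∀ {I J} → Hom I J → Term → Set
Image {I} f t = Σ Term λ s → Dom I s × map f s ≡ t

retract⇒Iso-Induced : ∀ {I J} (f : Hom I J) (g : Hom J I) →
                      (∀ t → Dom I t → map g (map f t) ≡ t) → Iso I (Induced J (Image f))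
retract⇒Iso-Induced {I} f g gf = record
  { to = record
    { map      = map f
    ; const-id = const-id f
    ; pres-Dom = λ t∈I → pres-Dom f t∈I , image t∈I
    ; pres-H   = λ e → pres-H f e , image (proj₁ (H-dom I e)) , image (proj₂ (H-dom I e))
    ; pres-V   = λ e → pres-V f e , image (proj₁ (V-dom I e)) , image (proj₂ (V-dom I e))
    }
  ; from = record
    { map      = map g
    ; const-id = const-id g
    ; pres-Dom = pres-Dom g ∘ proj₁
    ; pres-H   = pres-H g ∘ proj₁
    ; pres-V   = pres-V g ∘ proj₁
    }
  ; from-to = gf
  ; to-from = λ { _ (_ , (s , s∈I , refl)) → cong (map f) (gf s s∈I) }
  }
  where
  image : ∀ {t} → Dom I t → Image f (map f t)
  image t∈I = _ , t∈I , refl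

module GridImage (J : Instance) (a∈J : Dom J a) (ℓ : Term) (ℓH : H J ℓ ℓ) (ℓV : V J ℓ ℓ)
                 (grow : SatGrow J) (grid : SatGrid J) where

  record HPath : Set where
    field
      vertex : ℕ → Term
      edge   : ∀ i → H J (vertex i) (vertex (suc i))
  open HPath

  H-step : Σ Term (Dom J) → Σ Term (Dom J)
  H-step (t , t∈J) = let (t′ , _ , e , _) = grow t t∈J in t′ , proj₂ (H-dom J e)

  H-walk : ℕ → Σ Term (Dom J)
  H-walk zero    = a , a∈J
  H-walk (suc i) = H-step (H-walk i)

  firstRow : HPath
  vertex firstRow i = proj₁ (H-walk i)
  edge   firstRow i = let (t , t∈J) = H-walk i in proj₁ (proj₂ (proj₂ (grow t t∈J)))

  below : (p : HPath) → ∀ i → Σ Term λ t → V J (vertex p i) t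
  below p zero    = let (_ , t , _ , e) = grow (vertex p 0) (proj₁ (H-dom J (edge p 0))) in t , e
  below p (suc i) = let (t , _ , e) = grid _ _ _ (edge p i) (proj₂ (below p i)) in t , e

  nextRow : HPath → HPath
  vertex (nextRow p) i = proj₁ (below p i)
  edge   (nextRow p) i = proj₁ (proj₂ (grid _ _ _ (edge p i) (proj₂ (below p i))))

  row : ℕ → HPath
  row zero    = firstRow
  row (suc j) = nextRow (row j)

  image : ℕ → ℕ → Term
  image i j = vertex (row j) i

  image-H : ∀ i j → H J (image i j) (image (suc i) j)
  image-H i j = edge (row j) i

  image-V : ∀ i j → V J (image i j) (image i (suc j))
  image-V i j = proj₂ (below (row j) i)

  image-null : ℕ → Term
  image-null zero        = ℓ
  image-null k@(suc _) = uncurry′ image (decode k)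

  image-null-x : ∀ i j → image-null (2 ^ i * suc (2 * j)) ≡ image i j
  image-null-x i j with 2 ^ i * suc (2 * j) | x-index≢0 i j | decode-x i j
  ... | zero  | k≢0 | _       = ⊥-elim (k≢0 refl)
  ... | suc _ | _   | decoded = cong (uncurry′ image) decoded

  mapJ : Term → Term
  mapJ (const c) = const c
  mapJ (null k)  = image-null k

  mapJ-pt : ∀ i j → mapJ (pt i j) ≡ image i j
  mapJ-pt zero    zero    = refl
  mapJ-pt zero    (suc j) = image-null-x 0 (suc j)
  mapJ-pt (suc i) j       = image-null-x (suc i) j

  hom : Hom G∞ J
  hom = record
    { map = mapJ ; const-id = λ _ → refl ; pres-Dom = pres-Dom′ ; pres-H = pres-H′ ; pres-V = pres-V′ }
    where
    pres-Dom′ : ∀ {t} → G∞-Dom t → Dom J (mapJ t)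
    pres-Dom′ t∈G∞ with G∞-Dom⇒Vertex t∈G∞
    ... | inj₁ refl           = proj₁ (H-dom J ℓH)
    ... | inj₂ (i , j , refl) = subst (Dom J) (sym (mapJ-pt i j)) (proj₁ (H-dom J (image-H i j)))
    pres-H′ : ∀ {s t} → G∞-H s t → H J (mapJ s) (mapJ t)
    pres-H′ e with H-view e
    ... | inj₁ (refl , refl)         = ℓH
    ... | inj₂ (i , j , refl , refl) = subst₂ (H J) (sym (mapJ-pt i j)) (sym (mapJ-pt (suc i) j)) (image-H i j)
    pres-V′ : ∀ {s t} → G∞-V s t → V J (mapJ s) (mapJ t)
    pres-V′ e with V-view e
    ... | inj₁ (refl , refl)         = ℓV
    ... | inj₂ (i , j , refl , refl) = subst₂ (V J) (sym (mapJ-pt i j)) (sym (mapJ-pt i (suc j))) (image-V i j)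

G∞-universal : Universal G∞
G∞-universal = G∞-model , λ { J (a∈J , (ℓ , ℓH , ℓV) , grow , grid) → GridImage.hom J a∈J ℓ ℓH ℓV grow grid }

-- Well-decorated trees

-- s ≼ t: the node t lies in the subtree rooted at s (nodes are words stored last-letter-first).
_≼_ : Node → Node → Set
s ≼ t = Σ Node λ u → u ++ s ≡ t

_≼?_ : (s t : Node) → Dec (s ≼ t)
s ≼? t with ≡-dec _≟ᵇ_ s t
... | yes s≡t = yes ([] , s≡t)
s ≼? []      | no s≢t = no λ { ([] , s≡t) → s≢t s≡t ; (_ ∷ _ , ()) }
s ≼? (b ∷ t) | no s≢t with s ≼? t
... | yes (u , eq) = yes (b ∷ u , cong (b ∷_) eq)
... | no s⋠t       = no λ { ([] , s≡t) → s≢t s≡t ; (_ ∷ u , eq) → s⋠t (u , proj₂ (∷-injective eq)) }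

≼-length : ∀ {s t} → s ≼ t → length s ≤ length t
≼-length {s} (u , refl) = subst (length s ≤_) (sym (length-++ u)) (m≤n+m (length s) (length u))

≼-child : ∀ {s t} → s ≼ t → t ≡ s ⊎ Σ Bool λ b → (b ∷ s) ≼ t
≼-child {s} (u , eq) with initLast u
... | []       = inj₁ (sym eq)
... | u′ ∷ʳ′ b = inj₂ (b , u′ , trans (sym (∷ʳ-++ u′ b s)) eq)

≼-comparable : ∀ {s s′ t} → s ≼ t → s′ ≼ t → s′ ≼ s ⊎ s ≼ s′
≼-comparable ([] , refl)    (u′ , refl)       = inj₁ (u′ , refl)
≼-comparable (_ ∷ u , refl) ([] , eq)         = inj₂ (_ ∷ u , sym eq)
≼-comparable (_ ∷ u , refl) (_ ∷ u′ , eq) =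
  ≼-comparable (u , refl) (u′ , proj₂ (∷-injective eq))

encNode-injective : ∀ w w′ → encNode w ≡ encNode w′ → w ≡ w′
encNode-injective []          []           _  = refl
encNode-injective (false ∷ w) (false ∷ w′) eq =
  cong (false ∷_) (encNode-injective w w′ (*-cancelˡ-≡ (encNode w) (encNode w′) 2 (suc-injective eq)))
encNode-injective (true ∷ w)  (true ∷ w′)  eq =
  cong (true ∷_) (encNode-injective w w′ (*-cancelˡ-≡ (encNode w) (encNode w′) 2 (suc-injective (suc-injective eq))))
encNode-injective (false ∷ w) (true ∷ w′)  eq = ⊥-elim (even≢odd (encNode w) (encNode w′) (suc-injective eq))
encNode-injective (true ∷ w)  (false ∷ w′) eq = ⊥-elim (even≢odd (encNode w′) (encNode w) (sym (suc-injective eq)))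
encNode-injective []          (false ∷ _)  ()
encNode-injective []          (true ∷ _)   ()
encNode-injective (false ∷ _) []           ()
encNode-injective (true ∷ _)  []           ()

data Introducing {n} : Label n → Set where
  is-cnst : ∀ c k → Introducing (cnst c k)
  is-star : ∀ k → Introducing (star k)

Intro⇒Introducing : ∀ {n t} {l : Label n} {e k} → Intro t l e k → Introducing l
Intro⇒Introducing (intro-cnst c k) = is-cnst c k
Intro⇒Introducing (intro-star k)   = is-star k

Intro-functional : ∀ {n t} {l : Label n} {e e′ k k′} → Intro t l e k → Intro t l e′ k′ → e ≡ e′ × k ≡ k′
Intro-functional (intro-cnst _ _) (intro-cnst _ _) = refl , refl
Intro-functional (intro-star _)   (intro-star _)   = refl , refl

Introducing-¬void : ∀ {n} {l : Label n} → Introducing l → ¬ IsVoid l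
Introducing-¬void (is-cnst _ _) ()
Introducing-¬void (is-star _)   ()

colour-++ : ∀ {n} (d : Node → Label n) u b w s k →
            colour d (u ++ b ∷ w) s k ≡ colour d w s (colour d u (b ∷ w ++ s) k)
colour-++ d []      b w s k = refl
colour-++ d (c ∷ u) b w s k rewrite ++-assoc u (b ∷ w) s = colour-++ d u b w s _

introducing-children : ∀ {n} {l l₀ l₁ : Label n} → Introducing l → ChildCond l l₀ l₁ → IsVoid l₀ × IsVoid l₁
introducing-children (is-cnst _ _) c = c
introducing-children (is-star _)   c = c

void-children : ∀ {n} {l l₀ l₁ : Label n} → IsVoid l → ChildCond l l₀ l₁ → IsVoid l₀ × IsVoid l₁
void-children {l = void} _ c = c

select : ∀ {P : Bool → Set} → P false × P true → ∀ b → P b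
select (p , _) false = p
select (_ , p) true  = p

module Tree {n Cnst} {d : Node → Label n} (wd : WellDecorated n Cnst d) where
  open WellDecorated wd

  void-below : ∀ {s} → Introducing (d s) → ∀ u b → IsVoid (d (u ++ b ∷ s))
  void-below {s} ι []      = select {λ b → IsVoid (d (b ∷ s))} (introducing-children ι (children s))
  void-below {s} ι (c ∷ u) b = select {λ c → IsVoid (d (c ∷ u ++ b ∷ s))} (void-children (void-below ι u b) (children (u ++ b ∷ s))) c

  introducing-leaf : ∀ {s t} → Introducing (d s) → s ≼ t → Introducing (d t) → t ≡ s
  introducing-leaf ι s≼t ι′ with ≼-child s≼t
  ... | inj₁ t≡s             = t≡s
  ... | inj₂ (b , u , refl) = ⊥-elim (Introducing-¬void ι′ (void-below ι u b))

  Intro-node-unique : ∀ {t t′ e k k′} → Intro t (d t) e k → Intro t′ (d t′) e k′ → t ≡ t′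
  Intro-node-unique ι ι′ = go refl refl ι ι′ refl
    where
    go : ∀ {t t′ l l′ e e′ k k′} → d t ≡ l → d t′ ≡ l′ → Intro t l e k → Intro t′ l′ e′ k′ → e ≡ e′ → t ≡ t′
    go p p′ (intro-cnst c k) (intro-cnst _ k′) refl = cnst-once _ _ c k k′ p p′
    go _ _  (intro-star _)   (intro-star _)    eq   = encNode-injective _ _ (null-injective eq)
    go _ _  (intro-cnst _ _) (intro-star _)    ()
    go _ _  (intro-star _)   (intro-cnst _ _)  ()

  Intro-unique : ∀ {t t′ e k k′} → Intro t (d t) e k → Intro t′ (d t′) e k′ → t ≡ t′ × k ≡ k′
  Intro-unique ι ι′ with Intro-node-unique ι ι′
  ... | refl = refl , proj₂ (Intro-functional ι ι′)

  NotBelow : Node → Term → Set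
  NotBelow s e = ∀ u {k} → ¬ Intro (u ++ s) (d (u ++ s)) e k

  -- An element introduced below s is seen by the nodes above s only through its colour at s.
  Elem-transfer : ∀ {s s′ e₁ e₂ e′ c k k′} → Elem d s e₁ c → Elem d s e₂ c → NotBelow s e′ →
                  Elem d s′ e₁ k → Elem d s′ e′ k′ → Elem d s′ e₂ k
  Elem-transfer {s} {s′} (u₁ , k₁ , ι₁ , c₁) (u₂ , k₂ , ι₂ , c₂) below (v₁ , _ , ι₁′ , c₁′) (v′ , _ , ι′ , _)
    with Intro-unique ι₁ ι₁′
  ... | same-node , refl with ≼-comparable (u₁ , refl) (v₁ , sym same-node)
  ... | inj₂ (w , refl)     = ⊥-elim (below (v′ ++ w) (subst (λ t → Intro t (d t) _ _) (sym (++-assoc v′ w s)) ι′))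
  ... | inj₁ ([] , refl)    = ⊥-elim (below v′ ι′)
  ... | inj₁ (b ∷ w , refl) =
    u₂ ++ b ∷ w , k₂ , subst (λ t → Intro t (d t) _ k₂) (sym (++-assoc u₂ (b ∷ w) s′)) ι₂ , recoloured
    where
    open ≡-Reasoning
    path : u₁ ++ b ∷ w ≡ v₁
    path = ++-cancelʳ s′ (u₁ ++ b ∷ w) v₁ (trans (++-assoc u₁ (b ∷ w) s′) same-node)
    recoloured : colour d (u₂ ++ b ∷ w) s′ k₂ ≡ _
    recoloured = begin
      colour d (u₂ ++ b ∷ w) s′ k₂                   ≡⟨ colour-++ d u₂ b w s′ k₂ ⟩
      colour d w s′ (colour d u₂ (b ∷ w ++ s′) k₂) ≡⟨ cong (colour d w s′) (trans c₂ (sym c₁)) ⟩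
      colour d w s′ (colour d u₁ (b ∷ w ++ s′) k₁) ≡⟨ sym (colour-++ d u₁ b w s′ k₁) ⟩
      colour d (u₁ ++ b ∷ w) s′ k₁                   ≡⟨ cong (λ v → colour d v s′ k₁) path ⟩
      colour d v₁ s′ k₁                              ≡⟨ c₁′ ⟩
      _                                              ∎

  Added : (Fin n → Fin n → Label n) → Term → Term → Set
  Added lab e e′ = Σ Node λ s → Σ (Fin n) λ k → Σ (Fin n) λ k′ → d s ≡ lab k k′ × Elem d s e k × Elem d s e′ k′

  Added-transferˡ : ∀ {lab s e₁ e₂ e′ c} → Elem d s e₁ c → Elem d s e₂ c → NotBelow s e′ →
                    Added lab e₁ e′ → Added lab e₂ e′
  Added-transferˡ ε₁ ε₂ below (s′ , k , k′ , eq , ε₁′ , ε′) = s′ , k , k′ , eq , Elem-transfer ε₁ ε₂ below ε₁′ ε′ , ε′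

  Added-transferʳ : ∀ {lab s e₁ e₂ e′ c} → Elem d s e₁ c → Elem d s e₂ c → NotBelow s e′ →
                    Added lab e′ e₁ → Added lab e′ e₂
  Added-transferʳ ε₁ ε₂ below (s′ , k , k′ , eq , ε′ , ε₁′) = s′ , k , k′ , eq , ε′ , Elem-transfer ε₁ ε₂ below ε₁′ ε′

bounded-branch : ∀ {P : Node → Set} B → (∀ {s} → P s → Σ Bool λ b → P (b ∷ s)) →
                 (∀ {s} → P s → length s ≤ B) → ¬ P []
bounded-branch {P} B extend bounded p₀ = 1+n≰n (subst (_≤ B) depth (bounded p))
  where
  deep : ∀ k → Σ Node λ s → P s × length s ≡ k
  deep zero = [] , p₀ , refl
  deep (suc k) with deep k
  ... | s , p , refl = let (b , p′) = extend p in b ∷ s , p′ , refl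
  p : P (proj₁ (deep (suc B)))
  p = proj₁ (proj₂ (deep (suc B)))
  depth : length (proj₁ (deep (suc B))) ≡ suc B
  depth = proj₂ (proj₂ (deep (suc B)))

-- Cliquewidth

module GridInTree {n Cnst} {d : Node → Label n} (wd : WellDecorated n Cnst d)
                  (f : Hom G∞ (Rep d)) (g : Hom (Rep d) G∞) where
  open Tree wd

  N M m : ℕ
  N = n + n
  M = suc (N + N)
  m = suc M

  element : ℕ × ℕ → Term
  element (i , j) = map f (pt i j)

  retraction : ∀ i j → map g (element (i , j)) ≡ pt i j
  retraction i j = G∞-rigid (g ∘ᴴ f) (pt i j) (pt∈G∞ i j)

  element-injective : ∀ {p q} → element p ≡ element q → p ≡ q
  element-injective {i , j} {i′ , j′} eq =
    pt-injective (trans (sym (retraction i j)) (trans (cong (map g) eq) (retraction i′ j′)))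

  retract-H : ∀ {i j i′ j′} → Added addH (element (i , j)) (element (i′ , j′)) → G∞-H (pt i j) (pt i′ j′)
  retract-H e = subst₂ G∞-H (retraction _ _) (retraction _ _) (pres-H g e)

  retract-V : ∀ {i j i′ j′} → Added addV (element (i , j)) (element (i′ , j′)) → G∞-V (pt i j) (pt i′ j′)
  retract-V e = subst₂ G∞-V (retraction _ _) (retraction _ _) (pres-V g e)

  H-source : ∀ {p i j} → Added addH (element p) (element (suc i , j)) → p ≡ (i , j)
  H-source {i′ , j′} {i} {j} e = pt-injective (H-pred (retract-H {i′} {j′} {suc i} {j} e))

  H-target : ∀ {i j p} → Added addH (element (i , j)) (element p) → p ≡ (suc i , j)
  H-target {i} {j} {i′ , j′} e = pt-injective {i′} {j′} {suc i} {j} (H-succ (retract-H e))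

  V-source : ∀ {p i j} → Added addV (element p) (element (i , suc j)) → p ≡ (i , j)
  V-source {i′ , j′} {i} {j} e = pt-injective (V-pred (retract-V e))

  V-target : ∀ {i j p} → Added addV (element (i , j)) (element p) → p ≡ (i , suc j)
  V-target {i} {j} {i′ , j′} e = pt-injective {i′} {j′} {i} {suc j} (V-succ (retract-V e))

  introduction : (p : ℕ × ℕ) → Σ Node λ t → Σ (Fin n) λ k → Intro t (d t) (element p) k
  introduction (i , j) = pres-Dom f (pt∈G∞ i j)

  node : ℕ × ℕ → Node
  node p = proj₁ (introduction p)

  colour₀ : ℕ × ℕ → Fin n
  colour₀ p = proj₁ (proj₂ (introduction p))

  introduced : ∀ p → Intro (node p) (d (node p)) (element p) (colour₀ p)
  introduced p = proj₂ (proj₂ (introduction p))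

  Under : Node → ℕ × ℕ → Set
  Under s p = s ≼ node p

  Under? : ∀ s p → Dec (Under s p)
  Under? s p = s ≼? node p

  colourAt : ∀ {s p} → Under s p → Fin n
  colourAt {s} {p} (u , _) = colour d u s (colour₀ p)

  elemAt : ∀ {s p} (q : Under s p) → Elem d s (element p) (colourAt q)
  elemAt {p = p} (u , eq) =
    u , colour₀ p , subst (λ t → Intro t (d t) (element p) (colour₀ p)) (sym eq) (introduced p) , refl

  notBelow : ∀ {s p} → ¬ Under s p → NotBelow s (element p)
  notBelow {p = p} ¬q u ι = ¬q (u , proj₁ (Intro-unique ι (introduced p)))

  node-injective : ∀ {p q} → node p ≡ node q → p ≡ q
  node-injective {p} {q} eq = element-injective (proj₁ (Intro-functional (introduced p)
    (subst (λ t → Intro t (d t) (element q) (colour₀ q)) (sym eq) (introduced q))))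

  -- A line (row or column) ℓ is mixed at s if one of its edges has exactly one endpoint below s.
  -- By Added-transfer the colour at s of that endpoint determines ℓ, so at most 2n lines are mixed.
  module Lines (lab : Fin n → Fin n → Label n) (coords : ℕ → ℕ → ℕ × ℕ)
    (edge        : ∀ ℓ k → Added lab (element (coords ℓ k)) (element (coords ℓ (suc k))))
    (source-line : ∀ {ℓ k ℓ′ k′} → Added lab (element (coords ℓ′ k′)) (element (coords ℓ (suc k))) → ℓ′ ≡ ℓ)
    (target-line : ∀ {ℓ k ℓ′ k′} → Added lab (element (coords ℓ k)) (element (coords ℓ′ k′)) → ℓ′ ≡ ℓ)
    (s : Node) where

    On : ℕ → ℕ → Set
    On ℓ k = Under s (coords ℓ k)

    Leaves Enters Mixed : ℕ → Set
    Leaves ℓ = ∃ λ k → k < M × On ℓ k × ¬ On ℓ (suc k)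
    Enters ℓ = ∃ λ k → k < M × ¬ On ℓ k × On ℓ (suc k)
    Mixed ℓ  = Leaves ℓ ⊎ Enters ℓ

    mixed? : Decidable Mixed
    mixed? ℓ = anyUpTo? (λ k → Under? s _ ×-dec ¬? (Under? s _)) M
           ⊎-dec anyUpTo? (λ k → ¬? (Under? s _) ×-dec Under? s _) M

    leaves-signed : Signed Leaves n
    leaves-signed = record
      { signature           = λ (_ , _ , q , _) → colourAt q
      ; signature-injective = λ { (k , _ , q , ¬q₁) (_ , _ , q′ , _) eq → sym (source-line
          (Added-transferˡ (elemAt q) (subst (Elem d s _) (sym eq) (elemAt q′)) (notBelow ¬q₁) (edge _ k))) }
      }

    enters-signed : Signed Enters n
    enters-signed = record
      { signature           = λ (_ , _ , _ , q₁) → colourAt q₁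
      ; signature-injective = λ { (k , _ , ¬q , q₁) (_ , _ , _ , q₁′) eq → sym (target-line
          (Added-transferʳ (elemAt q₁) (subst (Elem d s _) (sym eq) (elemAt q₁′)) (notBelow ¬q) (edge _ k))) }
      }

    mixed-signed : Signed Mixed (n + n)
    mixed-signed = leaves-signed ⊎-signed enters-signed

    unmixed-uniform : ∀ {ℓ k k′} → ¬ Mixed ℓ → k < m → k′ < m → On ℓ k → On ℓ k′
    unmixed-uniform {ℓ} unmixed k<m k′<m = step-invariant⇒constant step (≤-pred k<m) (≤-pred k′<m)
      where
      step : ∀ k → k < M → (On ℓ k → On ℓ (suc k)) × (On ℓ (suc k) → On ℓ k)
      step k k<M =
        (λ q → decidable-stable (Under? s _) λ ¬q₁ → unmixed (inj₁ (k , k<M , q , ¬q₁))) ,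
        (λ q₁ → decidable-stable (Under? s _) λ ¬q → unmixed (inj₂ (k , k<M , ¬q , q₁)))

  module Rows = Lines addH (λ r i → i , r) (λ r i → pres-H f (G∞-H-pt i r))
    (λ {ℓ} {k} e → cong proj₂ (H-source {i = k} {ℓ} e)) (λ {ℓ} {k} e → cong proj₂ (H-target {k} {ℓ} e))
  module Cols = Lines addV (λ c j → c , j) (λ c j → pres-V f (G∞-V-pt c j))
    (λ {ℓ} {k} e → cong proj₁ (V-source {i = ℓ} {k} e)) (λ {ℓ} {k} e → cong proj₁ (V-target {ℓ} {k} e))

  FullRow : Node → Set
  FullRow s = ∃ λ r → r < m × (∀ {i} → i < m → Under s (i , r))

  FullRow? : ∀ s → Dec (FullRow s)
  FullRow? s = anyUpTo? (λ r → allUpTo? (λ i → Under? s (i , r)) m) m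

  FullRow-depth : ∀ {s} → FullRow s → length s ≤ maxUpTo m (λ r → length (node (0 , r)))
  FullRow-depth (r , r<m , full) = ≤-trans (≼-length (full z<s)) (≤-maxUpTo (λ r → length (node (0 , r))) r<m)

  introducing-¬FullRow : ∀ {s} → Introducing (d s) → ¬ FullRow s
  introducing-¬FullRow {s} ι (r , _ , full) with node-injective {0 , r} {1 , r} (trans (at-s 0 z<s) (sym (at-s 1 (s≤s z<s))))
    where
    at-s : ∀ i → i < m → node (i , r) ≡ s
    at-s i i<m = introducing-leaf ι (full i<m) (Intro⇒Introducing (introduced (i , r)))
  ... | ()

  -- Pigeonhole on colours: some row is mixed in neither child and some column is unmixed at s;
  -- that column carries the full row's element into the other row, hence into a child.
  FullRow-descends : ∀ {s} → FullRow s → ¬ (∀ b → ¬ FullRow (b ∷ s))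
  FullRow-descends {s} (r₀ , r₀<m , full) ¬full
    with ∃¬-signed (λ r → Rows.mixed? (false ∷ s) r ⊎-dec Rows.mixed? (true ∷ s) r)
                   (Rows.mixed-signed (false ∷ s) ⊎-signed Rows.mixed-signed (true ∷ s))
                   (m<n⇒m<1+n (n<1+n (N + N)))
       | ∃¬-signed (Cols.mixed? s) (Cols.mixed-signed s) (m≤n⇒m≤1+n (s≤s (m≤m+n N N)))
  ... | r , r<m , unmixed | c , c<m , unmixedᶜ
    with ≼-child (Cols.unmixed-uniform s unmixedᶜ r₀<m r<m (full c<m))
  ... | inj₁ at-s =
    introducing-¬FullRow (subst (Introducing ∘ d) at-s (Intro⇒Introducing (introduced (c , r)))) (r₀ , r₀<m , full)
  ... | inj₂ (b , q) =
    ¬full b (r , r<m , λ i<m → Rows.unmixed-uniform (b ∷ s) (unmixed ∘ in-child {λ t → Rows.Mixed t r} b) c<m i<m q)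
    where
    in-child : ∀ {P : Node → Set} b → P (b ∷ s) → P (false ∷ s) ⊎ P (true ∷ s)
    in-child false = inj₁
    in-child true  = inj₂

  FullRow-extends : ∀ {s} → FullRow s → Σ Bool λ b → FullRow (b ∷ s)
  FullRow-extends {s} full with FullRow? (false ∷ s) | FullRow? (true ∷ s)
  ... | yes full₀ | _         = false , full₀
  ... | no _      | yes full₁ = true , full₁
  ... | no ¬full₀ | no ¬full₁ = ⊥-elim (FullRow-descends full (select {λ b → ¬ FullRow (b ∷ s)} (¬full₀ , ¬full₁)))

  absurd : ⊥
  absurd = bounded-branch {FullRow} _ FullRow-extends FullRow-depth (0 , z<s , λ {i} _ → node (i , 0) , ++-identityʳ _)

¬FiniteCW-equivalent : ∀ {I} → FiniteCW I → Hom G∞ I → Hom I G∞ → ⊥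
¬FiniteCW-equivalent (_ , _ , _ , wd , _ , φ , _) f g = GridInTree.absurd wd (to φ ∘ᴴ f) (g ∘ᴴ from φ)

lemma32 : ¬ FiniteCW G∞
          × Universal G∞
          × (∀ (h : Hom G∞ G∞) t → Dom G∞ t → map h t ≡ t)
          × (∀ U → Universal U → Σ (Term → Set) λ S → Iso G∞ (Induced U S))
          × ¬ (Σ Instance λ U → Universal U × FiniteCW U)
lemma32 =
    (λ cw → ¬FiniteCW-equivalent cw idᴴ idᴴ)
  , G∞-universal
  , G∞-rigid
  , (λ U uU → _ , retract⇒Iso-Induced (to-U uU) (from-U uU) (G∞-rigid (from-U uU ∘ᴴ to-U uU)))
  , (λ (U , uU , cw) → ¬FiniteCW-equivalent cw (to-U uU) (from-U uU))
  where
  to-U : ∀ {U} → Universal U → Hom G∞ U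
  to-U uU = universal-hom G∞-universal (proj₁ uU)
  from-U : ∀ {U} → Universal U → Hom U G∞
  from-U uU = universal-hom uU G∞-model
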